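{- Let $k$ and $l$ be positive integers with $l \le k$ and $l \mid k$, and let $k' = \frac{2^{l}}{l}k$. Let $X_1, \ldots, X_l$ be sequences $X_j = x_{j,1}, x_{j,2}, \ldots, x_{j,k'}$ of length $k'$, where all the elements $x_{j,r}$ ($1 \le j \le l$, $1 \le r \le k'$) are pairwise distinct. Then one can construct a $k$-uniform hypergraph $G_{X_1,\ldots,X_l}$ on the vertex set $\{x_{j,r}\}$ with at most $k'^{l}\binom{k'}{k/l}$ edges such that every red/blue coloring $c$ of the elements which has the same majority in $X_1, \ldots, X_l$ yields a monochromatic edge of $G_{X_1,\ldots,X_l}$.
   Context: For a red/blue coloring $c$ and a sequence $X_j$ of length $k'$, $c$ has a red majority (resp. blue majority) in $X_j$ if at least $\frac{k'}{2}$ of the elements $x_{j,1}, \ldots, x_{j,k'}$ are colored red (resp. blue). The coloring $c$ has the same majority in $X_1, \ldots, X_l$ if either $c$ has a red majority in every $X_j$, or $c$ has a blue majority in every $X_j$. A hypergraph is $k$-uniform if every edge has exactly $k$ vertices. -}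

module Defs where

open import Data.Nat using (ℕ; zero; suc; _+_; _*_; _≤_)
open import Data.Bool using (Bool; true; false; if_then_else_; not)
open import Data.Fin using (Fin; zero; suc)
open import Data.List using (List; length)
open import Data.List.Relation.Unary.All using (All)
open import Data.List.Relation.Unary.Unique.Propositional using (Unique)
open import Data.Product using (Σ; ∃; ∃₂; _×_)
open import Data.Sum using (_⊎_)
open import Relation.Binary.PropositionalEquality using (_≡_)
open import Function using (_∘_)
open import Data.List.Membership.Propositional using (_∈_)

countTrue : ∀ {n} → (Fin n → Bool) → ℕ
countTrue {zero}  f = 0
countTrue {suc n} f = (if f zero then 1 else 0) + countTrue (f ∘ suc)

-- A red/blue colouring of V: true = red, false = blue.
Colouring : Set → Set
Colouring V = V → Bool

Seq : Set → ℕ → Set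
Seq V m = Fin m → V

RedMajority : ∀ {V m} → Colouring V → Seq V m → Set
RedMajority {m = m} c X = m ≤ 2 * countTrue (λ r → c (X r))

BlueMajority : ∀ {V m} → Colouring V → Seq V m → Set
BlueMajority {m = m} c X = m ≤ 2 * countTrue (λ r → not (c (X r)))

SameMajority : ∀ {V m l} → Colouring V → (Fin l → Seq V m) → Set
SameMajority c X = (∀ j → RedMajority c (X j)) ⊎ (∀ j → BlueMajority c (X j))

Hypergraph : Set → Set
Hypergraph V = List (List V)

IsKSet : ∀ {V} → ℕ → List V → Set
IsKSet k e = Unique e × length e ≡ k

Uniform : ∀ {V} → ℕ → Hypergraph V → Set
Uniform k G = All (IsKSet k) G

OnVertexSet : ∀ {V} → (V → Set) → Hypergraph V → Set
OnVertexSet S G = All (All S) G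

numEdges : ∀ {V} → Hypergraph V → ℕ
numEdges = length

HasMonochromaticEdge : ∀ {V} → Colouring V → Hypergraph V → Set
HasMonochromaticEdge {V} c G =
  Σ (List V) λ e → (e ∈ G) × ∃ λ b → All (λ v → c v ≡ b) e

module Submission where

-- Put N = 2^l (k/l) and m = k/l. For a shift vector v ∈ (ℤ/N)^l and an m-subset S of ℤ/N, let
-- e(v, S) be the union over j of the positions S + v_j in X_j; these N^l (N choose m) k-sets are
-- the edges. If every X_j has a red half P_j, averaging over one shift gives
-- ∑_s |A ∩ (P_j − s)| = |A| |P_j| ≥ N |A| / 2, so some shift keeps at least half of A. Starting
-- from A = ℤ/N and intersecting with the l shifted red sets in turn leaves at least N / 2^l = m
-- common positions, and any m of them form an all-red edge.

open import Data.Bool using (Bool; true; false; _∧_; not; if_then_else_)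
open import Data.Bool.Properties using (∧-assoc; ∧-identityʳ; not-injective)
open import Data.Empty using (⊥)
open import Data.Fin using (Fin; zero; suc; toℕ)
open import Data.Fin.Properties using (toℕ-fromℕ<; toℕ-injective; toℕ<n; suc-injective)
import Data.Fin.Permutation as Permutation
open import Data.List using (List; []; _∷_; [_]; map; _++_; length; allFin; cartesianProductWith)
open import Data.List.Properties using (length-map; length-++; length-tabulate)
open import Data.List.Membership.Propositional using (_∈_)
open import Data.List.Membership.Propositional.Properties
  using (∈-map⁺; ∈-map⁻; ∈-++⁺ˡ; ∈-++⁺ʳ; ∈-allFin; ∈-cartesianProductWith⁺)
open import Data.List.Relation.Unary.All as All using (All; []; _∷_)
import Data.List.Relation.Unary.All.Properties as All
open import Data.List.Relation.Unary.AllPairs using ([]; _∷_)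
open import Data.List.Relation.Unary.Any using (here)
open import Data.List.Relation.Unary.Unique.Propositional using (Unique)
import Data.List.Relation.Unary.Unique.Propositional.Properties as Unique
open import Data.Nat using (ℕ; zero; suc; _+_; _*_; _∸_; _^_; _≤_; NonZero; >-nonZero; s≤s; z≤n)
open import Data.Nat.Combinatorics using (_C_; k>n⇒nCk≡0; nCk+nC[k+1]≡[n+1]C[k+1])
open import Data.Nat.Divisibility using (_∣_)
open import Data.Nat.DivMod
  using (_/_; _%_; _mod_; m*[n/m]≡n; m≥n⇒m/n>0; m%n<n; %-distribˡ-+; m%n%n≡m%n; [m+n]%n≡m%n; m<n⇒m%n≡m)
open import Data.Nat.Properties hiding (suc-injective)
open import Data.Product using (Σ; ∃; ∃₂; _×_; _,_; proj₁; proj₂)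
open import Data.Sum using (inj₁; inj₂)
open import Data.Vec using (Vec; []; _∷_)
open import Function using (_∘_)
open import Relation.Binary.PropositionalEquality hiding ([_])
open import Relation.Nullary using (yes; no)
open import Algebra.Properties.CommutativeSemigroup *-commutativeSemigroup using (x∙yz≈y∙xz)
open import Algebra.Properties.Semiring.Sum +-*-semiring
  using (sum; ∑-comm; ∑-permute; *-distribˡ-sum; *-distribʳ-sum; sum-cong-≗)

open import Defs

module _ {A B C : Set} (f : A → B → C) where

  length-cartesianProductWith : ∀ xs ys → length (cartesianProductWith f xs ys) ≡ length xs * length ys
  length-cartesianProductWith []       ys = refl
  length-cartesianProductWith (x ∷ xs) ys = begin
    length (map (f x) ys ++ cartesianProductWith f xs ys)  ≡⟨ length-++ (map (f x) ys) ⟩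
    length (map (f x) ys) + length (cartesianProductWith f xs ys)
      ≡⟨ cong₂ _+_ (length-map (f x) ys) (length-cartesianProductWith xs ys) ⟩
    length ys + length xs * length ys                      ∎
    where open ≡-Reasoning

  All-cartesianProductWith : ∀ {P : C → Set} xs ys → (∀ x {y} → y ∈ ys → P (f x y)) →
    All P (cartesianProductWith f xs ys)
  All-cartesianProductWith []       ys Pf = []
  All-cartesianProductWith (x ∷ xs) ys Pf =
    All.++⁺ (All.map⁺ (All.tabulate (Pf x))) (All-cartesianProductWith xs ys Pf)

allVecs : ∀ n l → List (Vec (Fin n) l)
allVecs n zero    = [ [] ]
allVecs n (suc l) = cartesianProductWith _∷_ (allFin n) (allVecs n l)

length-allVecs : ∀ n l → length (allVecs n l) ≡ n ^ l
length-allVecs n zero    = refl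
length-allVecs n (suc l) = trans (length-cartesianProductWith _∷_ (allFin n) (allVecs n l))
  (cong₂ _*_ (length-tabulate {n = n} (λ i → i)) (length-allVecs n l))

∈-allVecs : ∀ {n l} (v : Vec (Fin n) l) → v ∈ allVecs n l
∈-allVecs []      = here refl
∈-allVecs (s ∷ v) = ∈-cartesianProductWith⁺ _∷_ (∈-allFin s) (∈-allVecs v)

subsets : (n t : ℕ) → List (List (Fin n))
subsets n       zero    = [ [] ]
subsets zero    (suc t) = []
subsets (suc n) (suc t) = map (zero ∷_) (map (map suc) (subsets n t)) ++ map (map suc) (subsets n (suc t))

length-subsets : ∀ n t → length (subsets n t) ≡ n C t
length-subsets n       zero    = refl
length-subsets zero    (suc t) = sym (k>n⇒nCk≡0 {n = 0} {k = suc t} (s≤s z≤n))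
length-subsets (suc n) (suc t) = begin
  length (map (zero ∷_) (map (map suc) (subsets n t)) ++ map (map suc) (subsets n (suc t)))
    ≡⟨ length-++ (map (zero ∷_) (map (map suc) (subsets n t))) ⟩
  length (map (zero ∷_) (map (map suc) (subsets n t))) + length (map (map suc) (subsets n (suc t)))
    ≡⟨ cong₂ _+_ (trans (length-map _ (map (map suc) (subsets n t))) (length-map _ (subsets n t)))
                 (length-map _ (subsets n (suc t))) ⟩
  length (subsets n t) + length (subsets n (suc t))
    ≡⟨ cong₂ _+_ (length-subsets n t) (length-subsets n (suc t)) ⟩
  n C t + n C suc t
    ≡⟨ nCk+nC[k+1]≡[n+1]C[k+1] n t ⟩
  suc n C suc t ∎
  where open ≡-Reasoning

subsets-IsKSet : ∀ n t → All (IsKSet t) (subsets n t)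
subsets-IsKSet n       zero    = ([] , refl) ∷ []
subsets-IsKSet zero    (suc t) = []
subsets-IsKSet (suc n) (suc t) = All.++⁺
  (All.map⁺ (All.map⁺ (All.map insert-zero (subsets-IsKSet n t))))
  (All.map⁺ (All.map map-suc (subsets-IsKSet n (suc t))))
  where
  map-suc : ∀ {u S} → IsKSet u S → IsKSet u (map suc S)
  map-suc {S = S} (unique , len) = Unique.map⁺ suc-injective unique , trans (length-map suc S) len
  insert-zero : ∀ {S} → IsKSet t S → IsKSet (suc t) (zero ∷ map suc S)
  insert-zero S-kset with unique , len ← map-suc S-kset =
    (All.map⁺ (All.tabulate (λ _ ())) ∷ unique) , cong suc len

subsets-complete : ∀ n t (f : Fin n → Bool) → t ≤ countTrue f →
  ∃ λ S → S ∈ subsets n t × All (λ r → f r ≡ true) S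
subsets-complete n       zero    f _ = [] , here refl , []
subsets-complete (suc n) (suc t) f t≤∣f∣ with f zero in f₀≡true
... | true  with S , S∈ , all-true ← subsets-complete n t (f ∘ suc) (≤-pred t≤∣f∣) =
  zero ∷ map suc S , ∈-++⁺ˡ (∈-map⁺ (zero ∷_) (∈-map⁺ (map suc) S∈)) , f₀≡true ∷ All.map⁺ all-true
... | false with S , S∈ , all-true ← subsets-complete n (suc t) (f ∘ suc) t≤∣f∣ =
  map suc S , ∈-++⁺ʳ (map (zero ∷_) (map (map suc) (subsets n t))) (∈-map⁺ (map suc) S∈) , All.map⁺ all-true

𝟙 : Bool → ℕ
𝟙 b = if b then 1 else 0

𝟙-∧ : ∀ a b → 𝟙 (a ∧ b) ≡ 𝟙 a * 𝟙 b
𝟙-∧ false b = refl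
𝟙-∧ true  b = sym (*-identityˡ (𝟙 b))

countTrue≡sum : ∀ {n} (f : Fin n → Bool) → countTrue f ≡ sum (𝟙 ∘ f)
countTrue≡sum {zero}  f = refl
countTrue≡sum {suc n} f = cong (𝟙 (f zero) +_) (countTrue≡sum (f ∘ suc))

countTrue-cong : ∀ {n} {f g : Fin n → Bool} → (∀ i → f i ≡ g i) → countTrue f ≡ countTrue g
countTrue-cong {f = f} {g} f≗g = begin
  countTrue f   ≡⟨ countTrue≡sum f ⟩
  sum (𝟙 ∘ f)   ≡⟨ sum-cong-≗ (cong 𝟙 ∘ f≗g) ⟩
  sum (𝟙 ∘ g)   ≡⟨ countTrue≡sum g ⟨
  countTrue g   ∎
  where open ≡-Reasoning

countTrue-∧≡∑* : ∀ {n} (f g : Fin n → Bool) → countTrue (λ i → f i ∧ g i) ≡ sum (λ i → 𝟙 (f i) * 𝟙 (g i))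
countTrue-∧≡∑* f g = trans (countTrue≡sum (λ i → f i ∧ g i)) (sum-cong-≗ (λ i → 𝟙-∧ (f i) (g i)))

countTrue-all : ∀ n → countTrue {n} (λ _ → true) ≡ n
countTrue-all zero    = refl
countTrue-all (suc n) = cong suc (countTrue-all n)

∃-sum≤n* : ∀ {n} .{{_ : NonZero n}} (g : Fin n → ℕ) → ∃ λ i → sum g ≤ n * g i
∃-sum≤n* {suc zero}    g = zero , ≤-refl
∃-sum≤n* {suc (suc n)} g with ∃-sum≤n* (g ∘ suc)
... | i , sum≤ with g zero ≤? g (suc i)
...   | yes g₀≤gᵢ = suc i , +-mono-≤ g₀≤gᵢ sum≤
...   | no  g₀≰gᵢ = zero , +-monoʳ-≤ (g zero) (≤-trans sum≤ (*-monoʳ-≤ (suc n) (<⇒≤ (≰⇒> g₀≰gᵢ))))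

module CyclicShift (N : ℕ) .{{_ : NonZero N}} where

  rotate : ℕ → Fin N → Fin N
  rotate a r = (toℕ r + a) mod N

  toℕ-rotate : ∀ a r → toℕ (rotate a r) ≡ (toℕ r + a) % N
  toℕ-rotate a r = toℕ-fromℕ< (m%n<n (toℕ r + a) N)

  rotate-+ : ∀ a b r → rotate b (rotate a r) ≡ rotate (a + b) r
  rotate-+ a b r = toℕ-injective (begin
    toℕ (rotate b (rotate a r))        ≡⟨ toℕ-rotate b (rotate a r) ⟩
    (toℕ (rotate a r) + b) % N          ≡⟨ cong (λ z → (z + b) % N) (toℕ-rotate a r) ⟩
    ((toℕ r + a) % N + b) % N           ≡⟨ %-distribˡ-+ ((toℕ r + a) % N) b N ⟩
    ((toℕ r + a) % N % N + b % N) % N   ≡⟨ cong (λ z → (z + b % N) % N) (m%n%n≡m%n (toℕ r + a) N) ⟩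
    ((toℕ r + a) % N + b % N) % N       ≡⟨ %-distribˡ-+ (toℕ r + a) b N ⟨
    (toℕ r + a + b) % N                 ≡⟨ cong (_% N) (+-assoc (toℕ r) a b) ⟩
    (toℕ r + (a + b)) % N               ≡⟨ toℕ-rotate (a + b) r ⟨
    toℕ (rotate (a + b) r)              ∎)
    where open ≡-Reasoning

  rotate-N : ∀ r → rotate N r ≡ r
  rotate-N r = toℕ-injective (begin
    toℕ (rotate N r)  ≡⟨ toℕ-rotate N r ⟩
    (toℕ r + N) % N   ≡⟨ [m+n]%n≡m%n (toℕ r) N ⟩
    toℕ r % N         ≡⟨ m<n⇒m%n≡m (toℕ<n r) ⟩
    toℕ r             ∎)
    where open ≡-Reasoning

  infixl 6 _⊕_ _⊖_

  _⊕_ : Fin N → Fin N → Fin N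
  r ⊕ s = rotate (toℕ s) r

  _⊖_ : Fin N → Fin N → Fin N
  r ⊖ s = rotate (N ∸ toℕ s) r

  ⊕-⊖-inverse : ∀ r s → r ⊕ s ⊖ s ≡ r
  ⊕-⊖-inverse r s = begin
    rotate (N ∸ toℕ s) (rotate (toℕ s) r)  ≡⟨ rotate-+ (toℕ s) (N ∸ toℕ s) r ⟩
    rotate (toℕ s + (N ∸ toℕ s)) r         ≡⟨ cong (λ a → rotate a r) (m+[n∸m]≡n (<⇒≤ (toℕ<n s))) ⟩
    rotate N r                             ≡⟨ rotate-N r ⟩
    r                                      ∎
    where open ≡-Reasoning

  ⊖-⊕-inverse : ∀ r s → r ⊖ s ⊕ s ≡ r
  ⊖-⊕-inverse r s = begin
    rotate (toℕ s) (rotate (N ∸ toℕ s) r)  ≡⟨ rotate-+ (N ∸ toℕ s) (toℕ s) r ⟩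
    rotate (N ∸ toℕ s + toℕ s) r           ≡⟨ cong (λ a → rotate a r) (m∸n+n≡m (<⇒≤ (toℕ<n s))) ⟩
    rotate N r                             ≡⟨ rotate-N r ⟩
    r                                      ∎
    where open ≡-Reasoning

  ⊕-comm : ∀ r s → r ⊕ s ≡ s ⊕ r
  ⊕-comm r s = cong (_mod N) (+-comm (toℕ r) (toℕ s))

  ⊕-cancelʳ : ∀ {r r′} s → r ⊕ s ≡ r′ ⊕ s → r ≡ r′
  ⊕-cancelʳ {r} {r′} s eq = begin
    r          ≡⟨ ⊕-⊖-inverse r s ⟨
    r ⊕ s ⊖ s  ≡⟨ cong (_⊖ s) eq ⟩
    r′ ⊕ s ⊖ s ≡⟨ ⊕-⊖-inverse r′ s ⟩
    r′         ∎
    where open ≡-Reasoning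

  shift : Fin N → Permutation.Permutation′ N
  shift s = Permutation.permutation (_⊕ s) (_⊖ s) (λ r → ⊖-⊕-inverse r s) (λ r → ⊕-⊖-inverse r s)

module Shifted (N : ℕ) .{{_ : NonZero N}} where

  open CyclicShift N

  ∑-countTrue-∧-shift : (A P : Fin N → Bool) →
    sum (λ s → countTrue (λ r → A r ∧ P (r ⊕ s))) ≡ countTrue A * countTrue P
  ∑-countTrue-∧-shift A P = begin
    sum (λ s → countTrue (λ r → A r ∧ P (r ⊕ s)))
      ≡⟨ sum-cong-≗ (λ s → countTrue-∧≡∑* A (λ r → P (r ⊕ s))) ⟩
    sum (λ s → sum (λ r → 𝟙 (A r) * 𝟙 (P (r ⊕ s))))
      ≡⟨ ∑-comm (λ s r → 𝟙 (A r) * 𝟙 (P (r ⊕ s))) ⟩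
    sum (λ r → sum (λ s → 𝟙 (A r) * 𝟙 (P (r ⊕ s))))
      ≡⟨ sum-cong-≗ (λ r → *-distribˡ-sum (𝟙 (A r)) (λ s → 𝟙 (P (r ⊕ s)))) ⟨
    sum (λ r → 𝟙 (A r) * sum (λ s → 𝟙 (P (r ⊕ s))))
      ≡⟨ sum-cong-≗ (λ r → cong (𝟙 (A r) *_) (∑-shifted r)) ⟩
    sum (λ r → 𝟙 (A r) * countTrue P)
      ≡⟨ *-distribʳ-sum (countTrue P) (𝟙 ∘ A) ⟨
    sum (𝟙 ∘ A) * countTrue P
      ≡⟨ cong (_* countTrue P) (countTrue≡sum A) ⟨
    countTrue A * countTrue P ∎
    where
    open ≡-Reasoning
    ∑-shifted : ∀ r → sum (λ s → 𝟙 (P (r ⊕ s))) ≡ countTrue P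
    ∑-shifted r = begin
      sum (λ s → 𝟙 (P (r ⊕ s)))  ≡⟨ sum-cong-≗ (λ s → cong (𝟙 ∘ P) (⊕-comm r s)) ⟩
      sum (λ s → 𝟙 (P (s ⊕ r)))  ≡⟨ ∑-permute (𝟙 ∘ P) (shift r) ⟨
      sum (𝟙 ∘ P)                ≡⟨ countTrue≡sum P ⟨
      countTrue P                ∎

  ∃-shift-halving : ∀ (A P : Fin N → Bool) → N ≤ 2 * countTrue P →
    ∃ λ s → countTrue A ≤ 2 * countTrue (λ r → A r ∧ P (r ⊕ s))
  ∃-shift-halving A P N≤2∣P∣ with ∃-sum≤n* (λ s → countTrue (λ r → A r ∧ P (r ⊕ s)))
  ... | s , ∑≤ = s , *-cancelˡ-≤ N (begin
    N * countTrue A                                ≡⟨ *-comm N (countTrue A) ⟩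
    countTrue A * N                                ≤⟨ *-monoʳ-≤ (countTrue A) N≤2∣P∣ ⟩
    countTrue A * (2 * countTrue P)                ≡⟨ x∙yz≈y∙xz (countTrue A) 2 (countTrue P) ⟩
    2 * (countTrue A * countTrue P)                ≡⟨ cong (2 *_) (∑-countTrue-∧-shift A P) ⟨
    2 * sum (λ s → countTrue (λ r → A r ∧ P (r ⊕ s)))  ≤⟨ *-monoʳ-≤ 2 ∑≤ ⟩
    2 * (N * countTrue (λ r → A r ∧ P (r ⊕ s)))    ≡⟨ x∙yz≈y∙xz N 2 _ ⟨
    N * (2 * countTrue (λ r → A r ∧ P (r ⊕ s)))    ∎)
    where
    open ≤-Reasoning

  ⋂-shifted : ∀ {l} → (Fin l → Fin N → Bool) → Vec (Fin N) l → Fin N → Bool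
  ⋂-shifted {zero}  P []      r = true
  ⋂-shifted {suc l} P (s ∷ v) r = P zero (r ⊕ s) ∧ ⋂-shifted (P ∘ suc) v r

  ∃-shifts-halving : ∀ {l} (P : Fin l → Fin N → Bool) → (∀ j → N ≤ 2 * countTrue (P j)) →
    ∀ A → ∃ λ v → countTrue A ≤ 2 ^ l * countTrue (λ r → A r ∧ ⋂-shifted P v r)
  ∃-shifts-halving {zero} P _ A =
    [] , ≤-reflexive (trans (countTrue-cong (sym ∘ ∧-identityʳ ∘ A)) (sym (*-identityˡ _)))
  ∃-shifts-halving {suc l} P large A
    with s , halved ← ∃-shift-halving A (P zero) (large zero)
    with v , rest ← ∃-shifts-halving (P ∘ suc) (large ∘ suc) (λ r → A r ∧ P zero (r ⊕ s))
    = s ∷ v , (begin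
      countTrue A                                    ≤⟨ halved ⟩
      2 * countTrue A′                               ≤⟨ *-monoʳ-≤ 2 rest ⟩
      2 * (2 ^ l * countTrue (λ r → A′ r ∧ ⋂ r))     ≡⟨ *-assoc 2 (2 ^ l) _ ⟨
      2 ^ suc l * countTrue (λ r → A′ r ∧ ⋂ r)       ≡⟨ cong (2 ^ suc l *_) (countTrue-cong (λ r → ∧-assoc (A r) _ _)) ⟩
      2 ^ suc l * countTrue (λ r → A r ∧ ⋂-shifted P (s ∷ v) r) ∎)
    where
    open ≤-Reasoning
    A′ ⋂ : Fin N → Bool
    A′ r = A r ∧ P zero (r ⊕ s)
    ⋂ = ⋂-shifted (P ∘ suc) v

  ∃-shifts-large-intersection : ∀ {l m} (P : Fin l → Fin N → Bool) → 2 ^ l * m ≤ N →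
    (∀ j → N ≤ 2 * countTrue (P j)) → ∃ λ v → m ≤ countTrue (⋂-shifted P v)
  ∃-shifts-large-intersection {l} {m} P 2ˡm≤N large
    with v , N≤2ˡ∣⋂∣ ← ∃-shifts-halving P large (λ _ → true)
    = v , *-cancelˡ-≤ (2 ^ l) {{m^n≢0 2 l}} (begin
      2 ^ l * m                             ≤⟨ 2ˡm≤N ⟩
      N                                     ≡⟨ countTrue-all N ⟨
      countTrue {N} (λ _ → true)            ≤⟨ N≤2ˡ∣⋂∣ ⟩
      2 ^ l * countTrue (⋂-shifted P v)     ∎)
    where open ≤-Reasoning

  module _ {V : Set} where

    shiftedEdge : ∀ {l} → (Fin l → Fin N → V) → Vec (Fin N) l → List (Fin N) → List V
    shiftedEdge y []      S = []
    shiftedEdge y (s ∷ v) S = map (λ r → y zero (r ⊕ s)) S ++ shiftedEdge (y ∘ suc) v S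

    shiftedEdge-vertices : ∀ {l} (y : Fin l → Fin N → V) v S →
      All (λ w → ∃₂ λ j r → y j r ≡ w) (shiftedEdge y v S)
    shiftedEdge-vertices y []      S = []
    shiftedEdge-vertices y (s ∷ v) S = All.++⁺
      (All.map⁺ (All.tabulate (λ {r} _ → zero , r ⊕ s , refl)))
      (All.map (λ (j , r , yjr≡w) → suc j , r , yjr≡w) (shiftedEdge-vertices (y ∘ suc) v S))

    length-shiftedEdge : ∀ {l} (y : Fin l → Fin N → V) v S → length (shiftedEdge y v S) ≡ l * length S
    length-shiftedEdge y []      S = refl
    length-shiftedEdge y (s ∷ v) S = trans (length-++ (map (λ r → y zero (r ⊕ s)) S))
      (cong₂ _+_ (length-map _ S) (length-shiftedEdge (y ∘ suc) v S))

    shiftedEdge-Unique : ∀ {l} (y : Fin l → Fin N → V) →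
      (∀ j₁ r₁ j₂ r₂ → y j₁ r₁ ≡ y j₂ r₂ → j₁ ≡ j₂ × r₁ ≡ r₂) →
      ∀ v {S} → Unique S → Unique (shiftedEdge y v S)
    shiftedEdge-Unique y y-inj []      S-unique = []
    shiftedEdge-Unique y y-inj (s ∷ v) {S} S-unique = Unique.++⁺
      (Unique.map⁺ (λ {r} {r′} eq → ⊕-cancelʳ s (proj₂ (y-inj zero (r ⊕ s) zero (r′ ⊕ s) eq))) S-unique)
      (shiftedEdge-Unique (y ∘ suc) y∘suc-inj v S-unique)
      disjoint
      where
      y∘suc-inj : ∀ j₁ r₁ j₂ r₂ → y (suc j₁) r₁ ≡ y (suc j₂) r₂ → j₁ ≡ j₂ × r₁ ≡ r₂
      y∘suc-inj j₁ r₁ j₂ r₂ eq with j₁≡j₂ , r₁≡r₂ ← y-inj (suc j₁) r₁ (suc j₂) r₂ eq = suc-injective j₁≡j₂ , r₁≡r₂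
      disjoint : ∀ {w} → w ∈ map (λ r → y zero (r ⊕ s)) S × w ∈ shiftedEdge (y ∘ suc) v S → ⊥
      disjoint (w∈row₀ , w∈rest) with ∈-map⁻ (λ r → y zero (r ⊕ s)) w∈row₀
      ... | r , _ , refl with j , r′ , eq ← All.lookup (shiftedEdge-vertices (y ∘ suc) v S) w∈rest
        with () ← y-inj (suc j) r′ zero (r ⊕ s) eq

    shiftedEdge-all : ∀ {l} (y : Fin l → Fin N → V) (g : V → Bool) v S →
      All (λ r → ⋂-shifted (λ j → g ∘ y j) v r ≡ true) S → All (λ w → g w ≡ true) (shiftedEdge y v S)
    shiftedEdge-all y g []      S _ = []
    shiftedEdge-all y g (s ∷ v) S ⋂-true = All.++⁺
      (All.map⁺ (All.map (proj₁ ∘ ∧-true) ⋂-true))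
      (shiftedEdge-all (y ∘ suc) g v S (All.map (proj₂ ∘ ∧-true) ⋂-true))
      where
      ∧-true : ∀ {a b} → a ∧ b ≡ true → a ≡ true × b ≡ true
      ∧-true {true} {true} _ = refl , refl

    shiftedHypergraph : ∀ {l} → (Fin l → Fin N → V) → ℕ → Hypergraph V
    shiftedHypergraph {l} y m = cartesianProductWith (shiftedEdge y) (allVecs N l) (subsets N m)

    module _ {l} (y : Fin l → Fin N → V) (m : ℕ) where

      shiftedHypergraph-Uniform : (∀ j₁ r₁ j₂ r₂ → y j₁ r₁ ≡ y j₂ r₂ → j₁ ≡ j₂ × r₁ ≡ r₂) →
        Uniform (l * m) (shiftedHypergraph y m)
      shiftedHypergraph-Uniform y-inj = All-cartesianProductWith (shiftedEdge y) (allVecs N l) (subsets N m)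
        λ v S∈ → let S-unique , ∣S∣≡m = All.lookup (subsets-IsKSet N m) S∈ in
          shiftedEdge-Unique y y-inj v S-unique ,
          trans (length-shiftedEdge y v _) (cong (l *_) ∣S∣≡m)

      shiftedHypergraph-OnVertexSet : OnVertexSet (λ w → ∃₂ λ j r → y j r ≡ w) (shiftedHypergraph y m)
      shiftedHypergraph-OnVertexSet = All-cartesianProductWith (shiftedEdge y) (allVecs N l) (subsets N m)
        λ v {S} _ → shiftedEdge-vertices y v S

      numEdges-shiftedHypergraph : numEdges (shiftedHypergraph y m) ≡ N ^ l * (N C m)
      numEdges-shiftedHypergraph =
        trans (length-cartesianProductWith (shiftedEdge y) (allVecs N l) (subsets N m))
              (cong₂ _*_ (length-allVecs N l) (length-subsets N m))

      shiftedHypergraph-all : 2 ^ l * m ≤ N → (g : V → Bool) → (∀ j → N ≤ 2 * countTrue (g ∘ y j)) →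
        Σ (List V) λ e → e ∈ shiftedHypergraph y m × All (λ w → g w ≡ true) e
      shiftedHypergraph-all 2ˡm≤N g large
        with v , m≤∣⋂∣ ← ∃-shifts-large-intersection (λ j → g ∘ y j) 2ˡm≤N large
        with S , S∈ , ⋂-true ← subsets-complete N m _ m≤∣⋂∣
        = shiftedEdge y v S , ∈-cartesianProductWith⁺ (shiftedEdge y) (∈-allVecs v) S∈ , shiftedEdge-all y g v S ⋂-true

proposition2p1 : (k l : ℕ) → .{{_ : NonZero l}} → .{{_ : NonZero k}} →
  l ≤ k → l ∣ k →
  (V : Set) →
  (x : Fin l → Seq V (2 ^ l * (k / l))) →
  (∀ j₁ r₁ j₂ r₂ → x j₁ r₁ ≡ x j₂ r₂ → (j₁ ≡ j₂ × r₁ ≡ r₂)) →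
  Σ (Hypergraph V) λ G →
    Uniform k G ×
    OnVertexSet (λ v → ∃₂ λ j r → x j r ≡ v) G ×
    numEdges G ≤ (2 ^ l * (k / l)) ^ l * ((2 ^ l * (k / l)) C (k / l)) ×
    ((c : Colouring V) → SameMajority c x → HasMonochromaticEdge c G)
proposition2p1 k l l≤k l∣k V x x-inj =
  G ,
  subst (λ k → Uniform k G) (m*[n/m]≡n l∣k) (shiftedHypergraph-Uniform x m x-inj) ,
  shiftedHypergraph-OnVertexSet x m ,
  ≤-reflexive (numEdges-shiftedHypergraph x m) ,
  monochromatic
  where
  m : ℕ
  m = k / l
  instance
    N≢0 : NonZero (2 ^ l * m)
    N≢0 = m*n≢0 (2 ^ l) m {{m^n≢0 2 l}} {{>-nonZero (m≥n⇒m/n>0 l≤k)}}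
  open Shifted (2 ^ l * m)
  G : Hypergraph V
  G = shiftedHypergraph x m
  monochromatic : (c : Colouring V) → SameMajority c x → HasMonochromaticEdge c G
  monochromatic c (inj₁ red)
    with e , e∈G , all-red ← shiftedHypergraph-all x m ≤-refl c red = e , e∈G , true , all-red
  monochromatic c (inj₂ blue)
    with e , e∈G , all-blue ← shiftedHypergraph-all x m ≤-refl (not ∘ c) blue
    = e , e∈G , false , All.map not-injective all-blue
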